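{- For every integer $n\ge 2$, the number of $3$-edge colorings of $K_n$ avoiding rainbow triangles satisfies $$c_{3,\widehat{F}_3}(K_n) \le \frac{3}{2}(n-1)!\cdot 2^{\binom{n}{2}}.$$
   Context: $c_{3,\widehat{F}_3}(K_n)$ is the number of maps $E(K_n)\to\{1,2,3\}$ such that no triangle has its three edges colored with three distinct colors. -}

module Defs where

open import Data.Nat using (ℕ; zero; suc; _<ᵇ_)
open import Data.Fin using (Fin; toℕ)
open import Data.Fin.Properties using (_≟_)
open import Data.Bool using (Bool; true; false; _∧_; _∨_; not; if_then_else_)
open import Data.List using (List; []; _∷_; length; map; concatMap; allFin; filterᵇ; zip; cartesianProduct)
open import Data.Product using (_×_; _,_)
open import Data.Bool.ListAction using (and)
open import Data.Vec using (Vec; []; _∷_; toList)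
open import Relation.Nullary.Decidable using (⌊_⌋)

-- Edges of K_n: unordered pairs {i,j} of distinct vertices, represented as
-- (i , j) with i < j; each edge appears exactly once in this list.
edges : (n : ℕ) → List (Fin n × Fin n)
edges n = filterᵇ (λ { (i , j) → toℕ i <ᵇ toℕ j }) (cartesianProduct (allFin n) (allFin n))

numEdges : ℕ → ℕ
numEdges n = length (edges n)

allVecs : (k m : ℕ) → List (Vec (Fin k) m)
allVecs k zero    = [] ∷ []
allVecs k (suc m) = concatMap (λ c → map (c ∷_) (allVecs k m)) (allFin k)

-- A 3-edge-colouring of K_n: a colour in Fin 3 for each edge of K_n,
-- given as the vector of colours of the edges in the order of 'edges n'.
Colouring : ℕ → Set
Colouring n = Vec (Fin 3) (numEdges n)

-- Colour of edge {i,j} (i < j) under a colouring (the list has exactly one match).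
lookupColour : {n : ℕ} → List ((Fin n × Fin n) × Fin 3) → Fin n → Fin n → Fin 3
lookupColour []                    i j = Fin.zero
  where import Data.Fin as Fin
lookupColour (((a , b) , c) ∷ rest) i j =
  if ⌊ a ≟ i ⌋ ∧ ⌊ b ≟ j ⌋ then c else lookupColour rest i j

colourOf : {n : ℕ} → Colouring n → Fin n → Fin n → Fin 3
colourOf {n} χ = lookupColour (zip (edges n) (toList χ))

allDistinct : Fin 3 → Fin 3 → Fin 3 → Bool
allDistinct x y z = not ⌊ x ≟ y ⌋ ∧ not ⌊ y ≟ z ⌋ ∧ not ⌊ x ≟ z ⌋

triangles : (n : ℕ) → List (Fin n × Fin n × Fin n)
triangles n = filterᵇ (λ { (i , j , k) → (toℕ i <ᵇ toℕ j) ∧ (toℕ j <ᵇ toℕ k) })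
  (cartesianProduct (allFin n) (cartesianProduct (allFin n) (allFin n)))

rainbowTriangleFree : {n : ℕ} → Colouring n → Bool
rainbowTriangleFree {n} χ =
  and (map (λ { (i , j , k) → not (allDistinct (colourOf χ i j) (colourOf χ j k) (colourOf χ i k)) })
      (triangles n))

c3RainbowFree : ℕ → ℕ
c3RainbowFree n = length (filterᵇ (rainbowTriangleFree {n}) (allVecs 3 (numEdges n)))

-- Colour K_{n+1} by colouring the copy of K_n on the vertices 1 … n and then the star at the new
-- vertex 0. Once the K_n part χ is fixed and rainbow-free, the star is admissible iff no triangle
-- {0, v, u} is rainbow, so colouring {0, v} with x only cuts down the palette of allowed colours at
-- every other u. Let J and K count the vertices whose palette has at least two, resp. all three
-- colours. The number of admissible completions is at most 2^J + 2^K − 1: branch over the colours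
-- of one star edge {0, w}, choosing w with a non-full palette whenever there is one (the count does
-- not depend on the order of the vertices); a full palette at u stays full only in the branch
-- x = χ(u, w), so the branches share the K full vertices. Starting from full palettes this gives
-- c(K_{n+1}) ≤ 2^{n+1} c(K_n), and the theorem follows by induction from c(K_2) = 3, using
-- 2^{n+1} ≤ n 2^n for n ≥ 2.

module Submission where

open import Defs

open import Algebra.Bundles using (CommutativeMonoid)
import Algebra.Properties.CommutativeSemigroup as CommSemigroupProperties
open import Data.Bool using (Bool; true; false; _∧_; not; if_then_else_; T; T?)
open import Data.Bool.ListAction using (all)
open import Data.Bool.Properties using (∧-commutativeMonoid; T-∧) renaming (_≟_ to _≟ᵇ_)
open import Data.Empty using (⊥-elim)
import Data.Fin as Fin
open import Data.Fin using (Fin; zero; suc; toℕ)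
open import Data.Fin.Properties using (_≟_)
import Data.Fin.Properties as Finₚ
open import Data.Fin.Subset using (Subset; ⊤; _∩_; ∣_∣)
open import Data.Fin.Subset.Properties using (∣p∩q∣≤∣p∣; ∣p∣≤n; ∣p∣≡n⇒p≡⊤; ∩-identityˡ; ∩-commutativeMonoid)
open import Data.List using (List; []; _∷_; length; map; _++_; concatMap; allFin; filterᵇ; zip; cartesianProduct)
open import Data.List.Membership.Propositional using (_∈_; find)
open import Data.List.Membership.Propositional.Properties
  using (∈-∃++; ∈-filter⁺; ∈-filter⁻; ∈-cartesianProduct⁺; ∈-allFin)
open import Data.List.Properties using (map-cong; map-++; map-∘; length-map; length-tabulate; map-tabulate; filter-++)
open import Data.List.Relation.Binary.Permutation.Propositional as Perm using (_↭_)
import Data.List.Relation.Binary.Permutation.Propositional.Properties as Perm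
open import Data.List.Relation.Unary.All as All using (All; []; _∷_; all?)
open import Data.List.Relation.Unary.All.Properties using (¬All⇒Any¬; all⁺; all⁻)
import Data.List.Relation.Unary.AllPairs as AllPairs
open import Data.List.Relation.Unary.AllPairs using (AllPairs; []; _∷_)
import Data.List.Relation.Unary.AllPairs.Properties as AllPairsₚ
open import Data.List.Relation.Unary.Any using (here; there)
open import Data.Nat using (ℕ; zero; suc; _+_; _*_; _^_; _≤_; _<_; _≤?_; _<ᵇ_; z≤n; s≤s; s≤s⁻¹; s<s; z<s; _∸_; _!)
open import Data.Nat.Combinatorics using (_C_; nC1≡n; nCk+nC[k+1]≡[n+1]C[k+1])
open import Data.Nat.ListAction using (sum)
open import Data.Nat.ListAction.Properties using (sum-++; sum-↭)
open import Data.Nat.Properties hiding (_≟_)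
open import Algebra.Properties.CommutativeSemigroup +-commutativeSemigroup using (interchange)
open import Data.Nat.Solver using (module +-*-Solver)
open +-*-Solver using (solve; _:+_; _:*_; _:=_; con)
open import Data.Product using (_×_; _,_; proj₁; proj₂; ∃₂; map₁)
open import Data.Vec using ([]; _∷_; lookup; tabulate; toList)
open import Data.Vec.Properties using (lookup∘tabulate; lookup-zipWith; lookup-replicate; ≡-dec)
open import Function using (_∘_; id)
open import Function.Bundles using (Equivalence)
open import Relation.Binary.PropositionalEquality
open import Relation.Nullary.Decidable using (Dec; ⌊_⌋; yes; no)

private variable A B : Set

𝟙 : Bool → ℕ
𝟙 b = if b then 1 else 0

𝟙-≤-* : ∀ {p q r} → (T p → T q × T r) → 𝟙 p ≤ 𝟙 q * 𝟙 r
𝟙-≤-* {false}               _ = z≤n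
𝟙-≤-* {true}  {true} {true} _ = ≤-refl
𝟙-≤-* {true}  {false}       p⇒q×r = ⊥-elim (proj₁ (p⇒q×r _))
𝟙-≤-* {true}  {true} {false} p⇒q×r = ⊥-elim (proj₂ (p⇒q×r _))

∑ : List A → (A → ℕ) → ℕ
∑ xs f = sum (map f xs)

∑-cong : ∀ (xs : List A) {f g : A → ℕ} → (∀ x → f x ≡ g x) → ∑ xs f ≡ ∑ xs g
∑-cong xs f≗g = cong sum (map-cong f≗g xs)

∑-mono : ∀ (xs : List A) {f g : A → ℕ} → (∀ x → f x ≤ g x) → ∑ xs f ≤ ∑ xs g
∑-mono []       f≤g = z≤n
∑-mono (x ∷ xs) f≤g = +-mono-≤ (f≤g x) (∑-mono xs f≤g)

∑-++ : ∀ (xs ys : List A) (f : A → ℕ) → ∑ (xs ++ ys) f ≡ ∑ xs f + ∑ ys f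
∑-++ xs ys f = trans (cong sum (map-++ f xs ys)) (sum-++ (map f xs) (map f ys))

∑-map : ∀ (g : A → B) (xs : List A) (f : B → ℕ) → ∑ (map g xs) f ≡ ∑ xs (λ x → f (g x))
∑-map g xs f = cong sum (sym (map-∘ xs))

∑-concatMap : ∀ (g : A → List B) (xs : List A) (f : B → ℕ) →
  ∑ (concatMap g xs) f ≡ ∑ xs (λ x → ∑ (g x) f)
∑-concatMap g []       f = refl
∑-concatMap g (x ∷ xs) f = trans (∑-++ (g x) (concatMap g xs) f) (cong (∑ (g x) f +_) (∑-concatMap g xs f))

∑-*ˡ : ∀ (c : ℕ) (xs : List A) (f : A → ℕ) → ∑ xs (λ x → c * f x) ≡ c * ∑ xs f
∑-*ˡ c []       f = sym (*-zeroʳ c)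
∑-*ˡ c (x ∷ xs) f = trans (cong (c * f x +_) (∑-*ˡ c xs f)) (sym (*-distribˡ-+ c (f x) (∑ xs f)))

∑-+ : ∀ (xs : List A) (f g : A → ℕ) → ∑ xs (λ x → f x + g x) ≡ ∑ xs f + ∑ xs g
∑-+ []       f g = refl
∑-+ (x ∷ xs) f g = trans (cong (f x + g x +_) (∑-+ xs f g)) (interchange (f x) (g x) (∑ xs f) (∑ xs g))

∑-1≡length : ∀ (xs : List A) → ∑ xs (λ _ → 1) ≡ length xs
∑-1≡length []       = refl
∑-1≡length (x ∷ xs) = cong suc (∑-1≡length xs)

∑-zero : ∀ (xs : List A) → ∑ xs (λ _ → 0) ≡ 0
∑-zero []       = refl
∑-zero (x ∷ xs) = ∑-zero xs

∑-comm : ∀ (xs : List A) (ys : List B) (F : A → B → ℕ) →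
  ∑ xs (λ x → ∑ ys (F x)) ≡ ∑ ys (λ y → ∑ xs (λ x → F x y))
∑-comm []       ys F = sym (∑-zero ys)
∑-comm (x ∷ xs) ys F = trans (cong (∑ ys (F x) +_) (∑-comm xs ys F)) (sym (∑-+ ys (F x) _))

∑-↭ : ∀ {xs ys : List A} (f : A → ℕ) → xs ↭ ys → ∑ xs f ≡ ∑ ys f
∑-↭ f p = sum-↭ (Perm.map⁺ f p)

∑-𝟙-∧ : ∀ b (xs : List A) (p : A → Bool) → ∑ xs (λ x → 𝟙 (b ∧ p x)) ≡ (if b then ∑ xs (λ x → 𝟙 (p x)) else 0)
∑-𝟙-∧ true  xs p = refl
∑-𝟙-∧ false xs p = ∑-zero xs

length-filterᵇ : ∀ (p : A → Bool) xs → length (filterᵇ p xs) ≡ ∑ xs (λ x → 𝟙 (p x))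
length-filterᵇ p []       = refl
length-filterᵇ p (x ∷ xs) with p x
... | true  = cong suc (length-filterᵇ p xs)
... | false = length-filterᵇ p xs

colourings : List A → List (List (A × Fin 3))
colourings []       = [] ∷ []
colourings (e ∷ es) = concatMap (λ c → map ((e , c) ∷_) (colourings es)) (allFin 3)

∑-colourings-∷ : ∀ (e : A) es (h : List (A × Fin 3) → ℕ) →
  ∑ (colourings (e ∷ es)) h ≡ ∑ (allFin 3) (λ c → ∑ (colourings es) (λ a → h ((e , c) ∷ a)))
∑-colourings-∷ e es h = trans (∑-concatMap (λ c → map ((e , c) ∷_) (colourings es)) (allFin 3) h)
                              (∑-cong (allFin 3) (λ c → ∑-map ((e , c) ∷_) (colourings es) h))

∑-allVecs : ∀ (es : List A) (h : List (A × Fin 3) → ℕ) →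
  ∑ (allVecs 3 (length es)) (λ cs → h (zip es (toList cs))) ≡ ∑ (colourings es) h
∑-allVecs []       h = refl
∑-allVecs (e ∷ es) h = begin
  ∑ (allVecs 3 (length (e ∷ es))) (λ cs → h (zip (e ∷ es) (toList cs)))
    ≡⟨ ∑-concatMap (λ c → map (c ∷_) (allVecs 3 (length es))) (allFin 3) (λ cs → h (zip (e ∷ es) (toList cs))) ⟩
  ∑ (allFin 3) (λ c → ∑ (map (c ∷_) (allVecs 3 (length es))) (λ cs → h (zip (e ∷ es) (toList cs))))
    ≡⟨ ∑-cong (allFin 3) (λ c → ∑-map (c ∷_) (allVecs 3 (length es)) (λ cs → h (zip (e ∷ es) (toList cs)))) ⟩
  ∑ (allFin 3) (λ c → ∑ (allVecs 3 (length es)) (λ cs → h ((e , c) ∷ zip es (toList cs))))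
    ≡⟨ ∑-cong (allFin 3) (λ c → ∑-allVecs es (λ a → h ((e , c) ∷ a))) ⟩
  ∑ (allFin 3) (λ c → ∑ (colourings es) (λ a → h ((e , c) ∷ a)))
    ≡⟨ ∑-colourings-∷ e es h ⟨
  ∑ (colourings (e ∷ es)) h
    ∎
  where open ≡-Reasoning

∑-colourings-++ : ∀ (xs ys : List A) (h : List (A × Fin 3) → ℕ) →
  ∑ (colourings (xs ++ ys)) h ≡ ∑ (colourings xs) (λ a → ∑ (colourings ys) (λ b → h (a ++ b)))
∑-colourings-++ []       ys h = sym (+-identityʳ _)
∑-colourings-++ (x ∷ xs) ys h = begin
  ∑ (colourings (x ∷ xs ++ ys)) h
    ≡⟨ ∑-colourings-∷ x (xs ++ ys) h ⟩
  ∑ (allFin 3) (λ c → ∑ (colourings (xs ++ ys)) (λ l → h ((x , c) ∷ l)))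
    ≡⟨ ∑-cong (allFin 3) (λ c → ∑-colourings-++ xs ys (λ l → h ((x , c) ∷ l))) ⟩
  ∑ (allFin 3) (λ c → ∑ (colourings xs) (λ a → ∑ (colourings ys) (λ b → h ((x , c) ∷ a ++ b))))
    ≡⟨ ∑-colourings-∷ x xs (λ a → ∑ (colourings ys) (λ b → h (a ++ b))) ⟨
  ∑ (colourings (x ∷ xs)) (λ a → ∑ (colourings ys) (λ b → h (a ++ b)))
    ∎
  where open ≡-Reasoning

∑-colourings-map : ∀ (f : A → B) (es : List A) (h : List (B × Fin 3) → ℕ) →
  ∑ (colourings (map f es)) h ≡ ∑ (colourings es) (λ a → h (map (map₁ f) a))
∑-colourings-map f []       h = refl
∑-colourings-map f (e ∷ es) h = begin
  ∑ (colourings (f e ∷ map f es)) h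
    ≡⟨ ∑-colourings-∷ (f e) (map f es) h ⟩
  ∑ (allFin 3) (λ c → ∑ (colourings (map f es)) (λ a → h ((f e , c) ∷ a)))
    ≡⟨ ∑-cong (allFin 3) (λ c → ∑-colourings-map f es (λ a → h ((f e , c) ∷ a))) ⟩
  ∑ (allFin 3) (λ c → ∑ (colourings es) (λ a → h ((f e , c) ∷ map (map₁ f) a)))
    ≡⟨ ∑-colourings-∷ e es (λ a → h (map (map₁ f) a)) ⟨
  ∑ (colourings (e ∷ es)) (λ a → h (map (map₁ f) a))
    ∎
  where open ≡-Reasoning

∑-colourings-mono : ∀ (es : List A) {f g : List (A × Fin 3) → ℕ} →
  (∀ a → map proj₁ a ≡ es → f a ≤ g a) → ∑ (colourings es) f ≤ ∑ (colourings es) g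
∑-colourings-mono []       f≤g = +-monoˡ-≤ 0 (f≤g [] refl)
∑-colourings-mono (e ∷ es) {f} {g} f≤g = begin
  ∑ (colourings (e ∷ es)) f
    ≡⟨ ∑-colourings-∷ e es f ⟩
  ∑ (allFin 3) (λ c → ∑ (colourings es) (λ a → f ((e , c) ∷ a)))
    ≤⟨ ∑-mono (allFin 3) (λ c → ∑-colourings-mono es (λ a dom → f≤g ((e , c) ∷ a) (cong (e ∷_) dom))) ⟩
  ∑ (allFin 3) (λ c → ∑ (colourings es) (λ a → g ((e , c) ∷ a)))
    ≡⟨ ∑-colourings-∷ e es g ⟨
  ∑ (colourings (e ∷ es)) g
    ∎
  where open ≤-Reasoning

private variable n : ℕ

elements : Subset n → List (Fin n)
elements []          = []
elements (true ∷ S)  = zero ∷ map suc (elements S)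
elements (false ∷ S) = map suc (elements S)

length-elements : (S : Subset n) → length (elements S) ≡ ∣ S ∣
length-elements []          = refl
length-elements (true ∷ S)  = cong suc (trans (length-map suc (elements S)) (length-elements S))
length-elements (false ∷ S) = trans (length-map suc (elements S)) (length-elements S)

∑⟨_⟩ : Subset n → (Fin n → ℕ) → ℕ
∑⟨ S ⟩ f = ∑ (elements S) f

∑⟨∩⟩ : ∀ (P T : Subset n) (f : Fin n → ℕ) → ∑⟨ P ∩ T ⟩ f ≡ ∑⟨ P ⟩ (λ x → if lookup T x then f x else 0)
∑⟨∩⟩-suc : ∀ (P T : Subset n) t (f : Fin (suc n) → ℕ) →
  ∑ (map suc (elements (P ∩ T))) f ≡ ∑ (map suc (elements P)) (λ x → if lookup (t ∷ T) x then f x else 0)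

∑⟨∩⟩ []          []          f = refl
∑⟨∩⟩ (true ∷ P)  (true ∷ T)  f = cong (f zero +_) (∑⟨∩⟩-suc P T true f)
∑⟨∩⟩ (true ∷ P)  (false ∷ T) f = ∑⟨∩⟩-suc P T false f
∑⟨∩⟩ (false ∷ P) (t ∷ T)     f = ∑⟨∩⟩-suc P T t f

∑⟨∩⟩-suc P T t f = begin
  ∑ (map suc (elements (P ∩ T))) f                                     ≡⟨ ∑-map suc (elements (P ∩ T)) f ⟩
  ∑⟨ P ∩ T ⟩ (λ x → f (suc x))                                          ≡⟨ ∑⟨∩⟩ P T (λ x → f (suc x)) ⟩
  ∑⟨ P ⟩ (λ x → if lookup T x then f (suc x) else 0)                    ≡⟨ sym (∑-map suc (elements P) _) ⟩
  ∑ (map suc (elements P)) (λ x → if lookup (t ∷ T) x then f x else 0) ∎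
  where open ≡-Reasoning

if-≤ : ∀ b (m : ℕ) → (if b then m else 0) ≤ m
if-≤ true  m = ≤-refl
if-≤ false m = z≤n

∑⟨∩⟩-≤ : ∀ (P T : Subset n) (f : Fin n → ℕ) → ∑⟨ P ∩ T ⟩ f ≤ ∑⟨ P ⟩ f
∑⟨∩⟩-≤ P T f = ≤-trans (≤-reflexive (∑⟨∩⟩ P T f)) (∑-mono (elements P) (λ x → if-≤ (lookup T x) (f x)))

∑⟨⟩-≤-∑⟨⊤⟩ : ∀ (S : Subset n) (f : Fin n → ℕ) → ∑⟨ S ⟩ f ≤ ∑⟨ ⊤ ⟩ f
∑⟨⟩-≤-∑⟨⊤⟩ S f = subst (λ P → ∑⟨ P ⟩ f ≤ ∑⟨ ⊤ ⟩ f) (∩-identityˡ S) (∑⟨∩⟩-≤ ⊤ S f)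

∑⟨∩⟩-comm : ∀ (P Q : Subset n) (R : Fin n → Subset n) → (∀ x y → lookup (R x) y ≡ lookup (R y) x) →
  ∀ (F : Fin n → Fin n → ℕ) →
  ∑⟨ P ⟩ (λ x → ∑⟨ Q ∩ R x ⟩ (F x)) ≡ ∑⟨ Q ⟩ (λ y → ∑⟨ P ∩ R y ⟩ (λ x → F x y))
∑⟨∩⟩-comm P Q R R-sym F = begin
  ∑⟨ P ⟩ (λ x → ∑⟨ Q ∩ R x ⟩ (F x))
    ≡⟨ ∑-cong (elements P) (λ x → ∑⟨∩⟩ Q (R x) (F x)) ⟩
  ∑⟨ P ⟩ (λ x → ∑⟨ Q ⟩ (λ y → if lookup (R x) y then F x y else 0))
    ≡⟨ ∑-comm (elements P) (elements Q) _ ⟩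
  ∑⟨ Q ⟩ (λ y → ∑⟨ P ⟩ (λ x → if lookup (R x) y then F x y else 0))
    ≡⟨ ∑-cong (elements Q) (λ y → ∑-cong (elements P) (λ x → cong (if_then F x y else 0) (R-sym x y))) ⟩
  ∑⟨ Q ⟩ (λ y → ∑⟨ P ⟩ (λ x → if lookup (R y) x then F x y else 0))
    ≡⟨ ∑-cong (elements Q) (λ y → ∑⟨∩⟩ P (R y) (λ x → F x y)) ⟨
  ∑⟨ Q ⟩ (λ y → ∑⟨ P ∩ R y ⟩ (λ x → F x y)) ∎
  where open ≡-Reasoning

atLeast : ℕ → Subset n → ℕ
atLeast k S = 𝟙 ⌊ k ≤? ∣ S ∣ ⌋

atLeast-∩ : ∀ k (S T : Subset n) → atLeast k (S ∩ T) ≤ atLeast k S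
atLeast-∩ k S T with k ≤? ∣ S ∩ T ∣ | k ≤? ∣ S ∣
... | yes _   | yes _   = ≤-refl
... | yes k≤∣S∩T∣ | no k≰∣S∣ = ⊥-elim (k≰∣S∣ (≤-trans k≤∣S∩T∣ (∣p∩q∣≤∣p∣ S T)))
... | no _    | _       = z≤n

_≟⊤ : (S : Subset n) → Dec (S ≡ ⊤)
S ≟⊤ = ≡-dec _≟ᵇ_ S ⊤

p≢⊤⇒∣p∣<n : (S : Subset n) → S ≢ ⊤ → ∣ S ∣ < n
p≢⊤⇒∣p∣<n S S≢⊤ = ≤∧≢⇒< (∣p∣≤n S) (λ ∣S∣≡n → S≢⊤ (∣p∣≡n⇒p≡⊤ ∣S∣≡n))

atLeast≡0 : ∀ k (S : Subset n) → ∣ S ∣ < k → atLeast k S ≡ 0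
atLeast≡0 k S ∣S∣<k with k ≤? ∣ S ∣
... | yes k≤∣S∣ = ⊥-elim (<⇒≱ ∣S∣<k k≤∣S∣)
... | no _      = refl

-- Palettes

nonRainbow : Fin 3 → Fin 3 → Subset 3
nonRainbow e x = tabulate (λ y → not (allDistinct x e y))

isYes-≟-sym : ∀ (x y : Fin n) → ⌊ x ≟ y ⌋ ≡ ⌊ y ≟ x ⌋
isYes-≟-sym x y with x ≟ y | y ≟ x
... | yes _   | yes _   = refl
... | no _    | no _    = refl
... | yes x≡y | no y≢x  = ⊥-elim (y≢x (sym x≡y))
... | no x≢y  | yes y≡x = ⊥-elim (x≢y (sym y≡x))

allDistinct-sym : ∀ x e y → allDistinct x e y ≡ allDistinct y e x
allDistinct-sym x e y
  rewrite isYes-≟-sym y e | isYes-≟-sym e x | isYes-≟-sym y x =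
  x∙yz≈y∙xz (not ⌊ x ≟ e ⌋) (not ⌊ e ≟ y ⌋) (not ⌊ x ≟ y ⌋)
  where open CommSemigroupProperties (CommutativeMonoid.commutativeSemigroup ∧-commutativeMonoid)

nonRainbow-sym : ∀ e x y → lookup (nonRainbow e x) y ≡ lookup (nonRainbow e y) x
nonRainbow-sym e x y = begin
  lookup (nonRainbow e x) y ≡⟨ lookup∘tabulate (λ z → not (allDistinct x e z)) y ⟩
  not (allDistinct x e y)   ≡⟨ cong not (allDistinct-sym x e y) ⟩
  not (allDistinct y e x)   ≡⟨ lookup∘tabulate (λ z → not (allDistinct y e z)) x ⟨
  lookup (nonRainbow e y) x ∎
  where open ≡-Reasoning

-- nonRainbow e x is the full palette exactly when x = e.
nonRainbow-full : ∀ e → ∑⟨ ⊤ ⟩ (λ x → atLeast 3 (nonRainbow e x)) ≡ 1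
nonRainbow-full zero             = refl
nonRainbow-full (suc zero)       = refl
nonRainbow-full (suc (suc zero)) = refl

∑-atLeast3-∩-nonRainbow : ∀ (S : Subset 3) e → ∑⟨ ⊤ ⟩ (λ x → atLeast 3 (S ∩ nonRainbow e x)) ≤ atLeast 3 S
∑-atLeast3-∩-nonRainbow S e with S ≟⊤
... | yes refl = ≤-reflexive (trans (∑-cong (elements ⊤) (λ x → cong (atLeast 3) (∩-identityˡ (nonRainbow e x))))
                                    (nonRainbow-full e))
... | no S≢⊤   = begin
  ∑⟨ ⊤ ⟩ (λ x → atLeast 3 (S ∩ nonRainbow e x)) ≤⟨ ∑-mono (elements ⊤) (λ x → atLeast-∩ 3 S (nonRainbow e x)) ⟩
  ∑⟨ ⊤ {3} ⟩ (λ _ → atLeast 3 S)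
    ≡⟨ ∑-cong (elements (⊤ {3})) (λ _ → atLeast≡0 3 S (p≢⊤⇒∣p∣<n S S≢⊤)) ⟩
  ∑⟨ ⊤ {3} ⟩ (λ _ → 0)                         ≤⟨ z≤n ⟩
  atLeast 3 S                                    ∎
  where open ≤-Reasoning

2^m+2^n≤2^[m+n]+1 : ∀ m n → 2 ^ m + 2 ^ n ≤ 2 ^ (m + n) + 1
2^m+2^n≤2^[m+n]+1 zero    n = ≤-reflexive (+-comm 1 (2 ^ n))
2^m+2^n≤2^[m+n]+1 (suc m) n = begin
  2 * 2 ^ m + 2 ^ n                    ≡⟨ solve 2 (λ p q → con 2 :* p :+ q := p :+ (p :+ q)) refl (2 ^ m) (2 ^ n) ⟩
  2 ^ m + (2 ^ m + 2 ^ n)              ≤⟨ +-mono-≤ (^-monoʳ-≤ 2 (m≤m+n m n)) (2^m+2^n≤2^[m+n]+1 m n) ⟩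
  2 ^ (m + n) + (2 ^ (m + n) + 1)      ≡⟨ solve 1 (λ p → p :+ (p :+ con 1) := con 2 :* p :+ con 1) refl (2 ^ (m + n)) ⟩
  2 * 2 ^ (m + n) + 1                  ∎
  where open ≤-Reasoning

branching-bound : ∀ (xs : List A) (a k : A → ℕ) J → (∀ x → a x + 1 ≤ 2 ^ J + 2 ^ k x) →
  ∑ xs a + 1 ≤ length xs * 2 ^ J + 2 ^ ∑ xs k
branching-bound []       a k J bound = ≤-refl
branching-bound (x ∷ xs) a k J bound = +-cancelʳ-≤ 1 _ _ (begin
  a x + ∑ xs a + 1 + 1
    ≡⟨ solve 2 (λ p q → p :+ q :+ con 1 :+ con 1 := (p :+ con 1) :+ (q :+ con 1)) refl (a x) (∑ xs a) ⟩
  (a x + 1) + (∑ xs a + 1)                             ≤⟨ +-mono-≤ (bound x) (branching-bound xs a k J bound) ⟩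
  (2 ^ J + 2 ^ k x) + (length xs * 2 ^ J + 2 ^ ∑ xs k)
    ≡⟨ solve 4 (λ p q l r → (p :+ q) :+ (l :* p :+ r) := (p :+ l :* p) :+ (q :+ r)) refl
               (2 ^ J) (2 ^ k x) (length xs) (2 ^ ∑ xs k) ⟩
  (2 ^ J + length xs * 2 ^ J) + (2 ^ k x + 2 ^ ∑ xs k) ≤⟨ +-monoʳ-≤ (2 ^ J + length xs * 2 ^ J) (2^m+2^n≤2^[m+n]+1 (k x) (∑ xs k)) ⟩
  (2 ^ J + length xs * 2 ^ J) + (2 ^ (k x + ∑ xs k) + 1) ≡⟨ +-assoc (2 ^ J + length xs * 2 ^ J) (2 ^ (k x + ∑ xs k)) 1 ⟨
  (2 ^ J + length xs * 2 ^ J) + 2 ^ (k x + ∑ xs k) + 1 ∎)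
  where open ≤-Reasoning

m≤2^[2≤m] : ∀ m → m ≤ 2 → m ≤ 2 ^ 𝟙 ⌊ 2 ≤? m ⌋
m≤2^[2≤m] 0 z≤n               = z≤n
m≤2^[2≤m] 1 (s≤s z≤n)         = ≤-refl
m≤2^[2≤m] 2 (s≤s (s≤s z≤n))   = ≤-refl

palette-weight : ∀ (S : Subset 3) J K → (S ≡ ⊤ → J ≤ K) →
  ∣ S ∣ * 2 ^ J + 2 ^ K ≤ 2 ^ (atLeast 2 S + J) + 2 ^ (atLeast 3 S + K)
palette-weight S J K full⇒J≤K with S ≟⊤
... | yes refl = full (full⇒J≤K refl)
  where
  open ≤-Reasoning
  full : J ≤ K → 3 * 2 ^ J + 2 ^ K ≤ 2 * 2 ^ J + 2 * 2 ^ K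
  full J≤K = begin
    3 * 2 ^ J + 2 ^ K           ≡⟨ solve 2 (λ p q → con 3 :* p :+ q := con 2 :* p :+ (p :+ q)) refl (2 ^ J) (2 ^ K) ⟩
    2 * 2 ^ J + (2 ^ J + 2 ^ K) ≤⟨ +-monoʳ-≤ (2 * 2 ^ J) (+-monoˡ-≤ (2 ^ K) (^-monoʳ-≤ 2 J≤K)) ⟩
    2 * 2 ^ J + (2 ^ K + 2 ^ K) ≡⟨ solve 2 (λ p q → con 2 :* p :+ (q :+ q) := con 2 :* p :+ con 2 :* q) refl (2 ^ J) (2 ^ K) ⟩
    2 * 2 ^ J + 2 * 2 ^ K       ∎
... | no S≢⊤ = +-mono-≤ size (≤-reflexive (cong (λ a → 2 ^ (a + K)) (sym (atLeast≡0 3 S (p≢⊤⇒∣p∣<n S S≢⊤)))))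
  where
  open ≤-Reasoning
  size : ∣ S ∣ * 2 ^ J ≤ 2 ^ (atLeast 2 S + J)
  size = begin
    ∣ S ∣ * 2 ^ J             ≤⟨ *-monoˡ-≤ (2 ^ J) (m≤2^[2≤m] ∣ S ∣ (s≤s⁻¹ (p≢⊤⇒∣p∣<n S S≢⊤))) ⟩
    2 ^ atLeast 2 S * 2 ^ J   ≡⟨ ^-distribˡ-+-* 2 (atLeast 2 S) J ⟨
    2 ^ (atLeast 2 S + J)     ∎

-- Completions of a star

module Extensions {V : Set} (χ : V → V → Fin 3) (χ-sym : ∀ u v → χ u v ≡ χ v u) where

  -- extensions vs L counts the colourings of the star edges {0, v}, v ∈ vs, within the palettes L v
  -- and with no rainbow triangle {0, v, u}; colouring {0, v} with x shrinks the palette at u.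
  restrict : V → Fin 3 → (V → Subset 3) → (V → Subset 3)
  restrict v x L u = L u ∩ nonRainbow (χ v u) x

  extensions : List V → (V → Subset 3) → ℕ
  extensions []       L = 1
  extensions (v ∷ vs) L = ∑⟨ L v ⟩ (λ x → extensions vs (restrict v x L))

  extensions-cong : ∀ vs {L L′ : V → Subset 3} → (∀ u → L u ≡ L′ u) → extensions vs L ≡ extensions vs L′
  extensions-cong []       L≗L′ = refl
  extensions-cong (v ∷ vs) {L} {L′} L≗L′ = trans
    (cong (λ S → ∑⟨ S ⟩ (λ x → extensions vs (restrict v x L))) (L≗L′ v))
    (∑-cong (elements (L′ v)) (λ x → extensions-cong vs (λ u → cong (_∩ nonRainbow (χ v u) x) (L≗L′ u))))

  restrict-comm : ∀ v x w y L u → restrict w y (restrict v x L) u ≡ restrict v x (restrict w y L) u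
  restrict-comm v x w y L u = xy∙z≈xz∙y (L u) (nonRainbow (χ v u) x) (nonRainbow (χ w u) y)
    where open CommSemigroupProperties (CommutativeMonoid.commutativeSemigroup (∩-commutativeMonoid 3))

  extensions-swap : ∀ v w vs L → extensions (v ∷ w ∷ vs) L ≡ extensions (w ∷ v ∷ vs) L
  extensions-swap v w vs L = begin
    ∑⟨ L v ⟩ (λ x → ∑⟨ L w ∩ nonRainbow (χ v w) x ⟩ (λ y → extensions vs (restrict w y (restrict v x L))))
      ≡⟨ ∑⟨∩⟩-comm (L v) (L w) (nonRainbow (χ v w)) (nonRainbow-sym (χ v w)) _ ⟩
    ∑⟨ L w ⟩ (λ y → ∑⟨ L v ∩ nonRainbow (χ v w) y ⟩ (λ x → extensions vs (restrict w y (restrict v x L))))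
      ≡⟨ ∑-cong (elements (L w)) (λ y →
           cong (λ e → ∑⟨ L v ∩ nonRainbow e y ⟩ (λ x → extensions vs (restrict w y (restrict v x L)))) (χ-sym v w)) ⟩
    ∑⟨ L w ⟩ (λ y → ∑⟨ L v ∩ nonRainbow (χ w v) y ⟩ (λ x → extensions vs (restrict w y (restrict v x L))))
      ≡⟨ ∑-cong (elements (L w)) (λ y → ∑-cong (elements (L v ∩ nonRainbow (χ w v) y))
           (λ x → extensions-cong vs (restrict-comm v x w y L))) ⟩
    ∑⟨ L w ⟩ (λ y → ∑⟨ L v ∩ nonRainbow (χ w v) y ⟩ (λ x → extensions vs (restrict v x (restrict w y L))))
      ∎
    where open ≡-Reasoning

  extensions-↭ : ∀ {vs ws} → vs ↭ ws → ∀ L → extensions vs L ≡ extensions ws L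
  extensions-↭ Perm.refl              L = refl
  extensions-↭ (Perm.prep v p)        L = ∑-cong (elements (L v)) (λ x → extensions-↭ p (restrict v x L))
  extensions-↭ (Perm.swap {vs} v w p) L = trans (extensions-swap v w vs L)
    (∑-cong (elements (L w)) (λ y → ∑-cong (elements (restrict w y L v)) (λ x → extensions-↭ p (restrict v x (restrict w y L)))))
  extensions-↭ (Perm.trans p q)       L = trans (extensions-↭ p L) (extensions-↭ q L)

  #atLeast : ℕ → (V → Subset 3) → List V → ℕ
  #atLeast k L vs = ∑ vs (λ u → atLeast k (L u))

  #atLeast-restrict : ∀ k w x L vs → #atLeast k (restrict w x L) vs ≤ #atLeast k L vs
  #atLeast-restrict k w x L vs = ∑-mono vs (λ u → atLeast-∩ k (L u) (nonRainbow (χ w u) x))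

  ∑-#atLeast3-restrict : ∀ w L vs → ∑⟨ ⊤ ⟩ (λ x → #atLeast 3 (restrict w x L) vs) ≤ #atLeast 3 L vs
  ∑-#atLeast3-restrict w L vs = ≤-trans
    (≤-reflexive (∑-comm (elements ⊤) vs (λ x u → atLeast 3 (restrict w x L u))))
    (∑-mono vs (λ u → ∑-atLeast3-∩-nonRainbow (L u) (χ w u)))

  #atLeast-full : ∀ L vs → All (λ u → L u ≡ ⊤) vs → #atLeast 2 L vs ≤ #atLeast 3 L vs
  #atLeast-full L []       []                = z≤n
  #atLeast-full L (u ∷ vs) (Lu≡⊤ ∷ Lvs≡⊤) rewrite Lu≡⊤ = s≤s (#atLeast-full L vs Lvs≡⊤)

  extensions-∷-bound : ∀ w rest L →
    (∀ L′ → extensions rest L′ + 1 ≤ 2 ^ #atLeast 2 L′ rest + 2 ^ #atLeast 3 L′ rest) →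
    extensions (w ∷ rest) L + 1 ≤ ∣ L w ∣ * 2 ^ #atLeast 2 L rest + 2 ^ #atLeast 3 L rest
  extensions-∷-bound w rest L bound = begin
    ∑⟨ L w ⟩ branch + 1
      ≤⟨ branching-bound (elements (L w)) branch full rich branch-bound ⟩
    length (elements (L w)) * 2 ^ rich + 2 ^ ∑⟨ L w ⟩ full
      ≤⟨ +-mono-≤ (≤-reflexive (cong (_* 2 ^ rich) (length-elements (L w))))
                  (^-monoʳ-≤ 2 (≤-trans (∑⟨⟩-≤-∑⟨⊤⟩ (L w) full) (∑-#atLeast3-restrict w L rest))) ⟩
    ∣ L w ∣ * 2 ^ rich + 2 ^ #atLeast 3 L rest
      ∎
    where
    open ≤-Reasoning
    rich : ℕ
    rich = #atLeast 2 L rest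
    branch full : Fin 3 → ℕ
    branch x = extensions rest (restrict w x L)
    full   x = #atLeast 3 (restrict w x L) rest
    branch-bound : ∀ x → branch x + 1 ≤ 2 ^ rich + 2 ^ full x
    branch-bound x = ≤-trans (bound (restrict w x L)) (+-monoˡ-≤ (2 ^ full x) (^-monoʳ-≤ 2 (#atLeast-restrict 2 w x L rest)))

  -- Prefer a vertex with a non-full palette; if there is none, all remaining palettes are full.
  pivot : ∀ L v vs → ∃₂ λ w rest → (v ∷ vs ↭ w ∷ rest) × (L w ≡ ⊤ → #atLeast 2 L rest ≤ #atLeast 3 L rest)
  pivot L v vs with all? (λ u → L u ≟⊤) vs
  ... | yes vs-full = v , vs , Perm.refl , (λ _ → #atLeast-full L vs vs-full)
  ... | no ¬vs-full with find (¬All⇒Any¬ (λ u → L u ≟⊤) vs ¬vs-full)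
  ...   | w , w∈vs , Lw≢⊤ with ∈-∃++ w∈vs
  ...     | ys , zs , refl = w , v ∷ ys ++ zs , Perm.shift w (v ∷ ys) zs , λ Lw≡⊤ → ⊥-elim (Lw≢⊤ Lw≡⊤)

  extensions-bound : ∀ vs L → extensions vs L + 1 ≤ 2 ^ #atLeast 2 L vs + 2 ^ #atLeast 3 L vs
  extensions-bound vs = bound (length vs) vs refl
    where
    bound : ∀ m vs → length vs ≡ m → ∀ L → extensions vs L + 1 ≤ 2 ^ #atLeast 2 L vs + 2 ^ #atLeast 3 L vs
    bound _       []       _   L = ≤-refl
    bound (suc m) (v ∷ vs) len L with pivot L v vs
    ... | w , rest , v∷vs↭w∷rest , full⇒J≤K = begin
      extensions (v ∷ vs) L + 1
        ≡⟨ cong (_+ 1) (extensions-↭ v∷vs↭w∷rest L) ⟩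
      extensions (w ∷ rest) L + 1
        ≤⟨ extensions-∷-bound w rest L (bound m rest (suc-injective (trans (sym (Perm.↭-length v∷vs↭w∷rest)) len))) ⟩
      ∣ L w ∣ * 2 ^ #atLeast 2 L rest + 2 ^ #atLeast 3 L rest
        ≤⟨ palette-weight (L w) (#atLeast 2 L rest) (#atLeast 3 L rest) full⇒J≤K ⟩
      2 ^ #atLeast 2 L (w ∷ rest) + 2 ^ #atLeast 3 L (w ∷ rest)
        ≡⟨ cong₂ (λ j k → 2 ^ j + 2 ^ k) (∑-↭ (λ u → atLeast 2 (L u)) v∷vs↭w∷rest)
                                          (∑-↭ (λ u → atLeast 3 (L u)) v∷vs↭w∷rest) ⟨
      2 ^ #atLeast 2 L (v ∷ vs) + 2 ^ #atLeast 3 L (v ∷ vs)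
        ∎
      where open ≤-Reasoning

  admissible : (V → Subset 3) → List (V × Fin 3) → Bool
  admissible L []            = true
  admissible L ((v , x) ∷ a) = lookup (L v) x ∧ admissible (restrict v x L) a

  ∑-admissible : ∀ vs L → ∑ (colourings vs) (λ a → 𝟙 (admissible L a)) ≡ extensions vs L
  ∑-admissible []       L = refl
  ∑-admissible (v ∷ vs) L = begin
    ∑ (colourings (v ∷ vs)) (λ a → 𝟙 (admissible L a))
      ≡⟨ ∑-colourings-∷ v vs (λ a → 𝟙 (admissible L a)) ⟩
    ∑ (allFin 3) (λ x → ∑ (colourings vs) (λ a → 𝟙 (lookup (L v) x ∧ admissible (restrict v x L) a)))
      ≡⟨ ∑-cong (allFin 3) (λ x → ∑-𝟙-∧ (lookup (L v) x) (colourings vs) (admissible (restrict v x L))) ⟩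
    ∑ (allFin 3) (λ x → if lookup (L v) x then ∑ (colourings vs) (λ a → 𝟙 (admissible (restrict v x L) a)) else 0)
      ≡⟨ ∑-cong (allFin 3) (λ x → cong (λ n → if lookup (L v) x then n else 0) (∑-admissible vs (restrict v x L))) ⟩
    ∑⟨ ⊤ ⟩ (λ x → if lookup (L v) x then extensions vs (restrict v x L) else 0)
      ≡⟨ ∑⟨∩⟩ ⊤ (L v) (λ x → extensions vs (restrict v x L)) ⟨
    ∑⟨ ⊤ ∩ L v ⟩ (λ x → extensions vs (restrict v x L))
      ≡⟨ cong (λ S → ∑⟨ S ⟩ (λ x → extensions vs (restrict v x L))) (∩-identityˡ (L v)) ⟩
    extensions (v ∷ vs) L
      ∎
    where open ≡-Reasoning

  admissible-intro : ∀ L a → All (λ (v , x) → T (lookup (L v) x)) a →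
    AllPairs (λ (v , x) (w , y) → T (lookup (nonRainbow (χ v w) x) y)) a → T (admissible L a)
  admissible-intro L []            []             []             = _
  admissible-intro L ((v , x) ∷ a) (x∈Lv ∷ a∈L) (compatible ∷ a-pairs) =
    Equivalence.from T-∧ (x∈Lv , admissible-intro (restrict v x L) a (All.zipWith ∈-restrict (a∈L , compatible)) a-pairs)
    where
    ∈-restrict : ∀ {(w , y) : V × Fin 3} → T (lookup (L w) y) × T (lookup (nonRainbow (χ v w) x) y) →
                 T (lookup (restrict v x L w) y)
    ∈-restrict {w , y} y∈ = subst T (sym (lookup-zipWith _∧_ y (L w) (nonRainbow (χ v w) x))) (Equivalence.from T-∧ y∈)

-- Complete graphs

nonRainbowTriangle : ∀ {m} → List ((Fin m × Fin m) × Fin 3) → Fin m × Fin m × Fin m → Bool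
nonRainbowTriangle l (i , j , k) = not (allDistinct (lookupColour l i j) (lookupColour l j k) (lookupColour l i k))

-- Definitionally, edges m = filterᵇ ordered (cartesianProduct (allFin m) (allFin m)), and triangles m
-- is the analogous filter with ordered₃.
ordered : ∀ {m} → Fin m × Fin m → Bool
ordered (i , j) = toℕ i <ᵇ toℕ j

ordered₃ : ∀ {m} → Fin m × Fin m × Fin m → Bool
ordered₃ (i , j , k) = (toℕ i <ᵇ toℕ j) ∧ (toℕ j <ᵇ toℕ k)

∈-triangles⁺ : ∀ {m} {i j k : Fin m} → i Fin.< j → j Fin.< k → (i , j , k) ∈ triangles m
∈-triangles⁺ {m} {i} {j} {k} i<j j<k =
  ∈-filter⁺ (T? ∘ ordered₃)
    (∈-cartesianProduct⁺ (∈-allFin i) (∈-cartesianProduct⁺ (∈-allFin j) (∈-allFin k)))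
    (Equivalence.from T-∧ (<⇒<ᵇ i<j , <⇒<ᵇ j<k))

∈-triangles⁻ : ∀ {m} {i j k : Fin m} → (i , j , k) ∈ triangles m → i Fin.< j × j Fin.< k
∈-triangles⁻ {m} t∈
  with i<ᵇj , j<ᵇk ← Equivalence.to T-∧ (proj₂ (∈-filter⁻ (T? ∘ ordered₃)
                       {xs = cartesianProduct (allFin m) (cartesianProduct (allFin m) (allFin m))} t∈))
  = <ᵇ⇒< _ _ i<ᵇj , <ᵇ⇒< _ _ j<ᵇk

rainbowFree : (m : ℕ) → List ((Fin m × Fin m) × Fin 3) → Bool
rainbowFree m l = all (nonRainbowTriangle l) (triangles m)

c3RainbowFree≡∑ : ∀ m → c3RainbowFree m ≡ ∑ (colourings (edges m)) (λ l → 𝟙 (rainbowFree m l))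
c3RainbowFree≡∑ m = trans (length-filterᵇ (rainbowTriangleFree {m}) (allVecs 3 (numEdges m)))
                          (∑-allVecs (edges m) (λ l → 𝟙 (rainbowFree m l)))

starEdge : Fin n → Fin (suc n) × Fin (suc n)
starEdge v = zero , suc v

sucEdge : Fin n × Fin n → Fin (suc n) × Fin (suc n)
sucEdge (i , j) = suc i , suc j

star-edges : ∀ (xs : List (Fin n)) → filterᵇ ordered (map (zero ,_) (map suc xs)) ≡ map starEdge xs
star-edges []       = refl
star-edges (x ∷ xs) = cong (starEdge x ∷_) (star-edges xs)

suc-row : ∀ (x : Fin n) ys → filterᵇ ordered (map (suc x ,_) (map suc ys)) ≡ map sucEdge (filterᵇ ordered (map (x ,_) ys))
suc-row x []       = refl
suc-row x (y ∷ ys) with toℕ x <ᵇ toℕ y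
... | true  = cong (sucEdge (x , y) ∷_) (suc-row x ys)
... | false = suc-row x ys

suc-edges : ∀ (xs ys : List (Fin n)) →
  filterᵇ ordered (cartesianProduct (map suc xs) (zero ∷ map suc ys)) ≡ map sucEdge (filterᵇ ordered (cartesianProduct xs ys))
suc-edges []       ys = refl
suc-edges (x ∷ xs) ys = begin
  filterᵇ ordered (map (suc x ,_) (map suc ys) ++ cartesianProduct (map suc xs) (zero ∷ map suc ys))
    ≡⟨ filter-++ (T? ∘ ordered) (map (suc x ,_) (map suc ys)) _ ⟩
  filterᵇ ordered (map (suc x ,_) (map suc ys)) ++ filterᵇ ordered (cartesianProduct (map suc xs) (zero ∷ map suc ys))
    ≡⟨ cong₂ _++_ (suc-row x ys) (suc-edges xs ys) ⟩
  map sucEdge (filterᵇ ordered (map (x ,_) ys)) ++ map sucEdge (filterᵇ ordered (cartesianProduct xs ys))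
    ≡⟨ map-++ sucEdge (filterᵇ ordered (map (x ,_) ys)) _ ⟨
  map sucEdge (filterᵇ ordered (map (x ,_) ys) ++ filterᵇ ordered (cartesianProduct xs ys))
    ≡⟨ cong (map sucEdge) (filter-++ (T? ∘ ordered) (map (x ,_) ys) (cartesianProduct xs ys)) ⟨
  map sucEdge (filterᵇ ordered (cartesianProduct (x ∷ xs) ys))
    ∎
  where open ≡-Reasoning

edges-suc : ∀ n → edges (suc n) ≡ map starEdge (allFin n) ++ map sucEdge (edges n)
edges-suc n = begin
  filterᵇ ordered (cartesianProduct (allFin (suc n)) (allFin (suc n)))
    ≡⟨ cong (λ vs → filterᵇ ordered (cartesianProduct vs vs)) (cong (zero ∷_) (map-tabulate id suc)) ⟨
  filterᵇ ordered (cartesianProduct (zero ∷ map suc (allFin n)) (zero ∷ map suc (allFin n)))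
    ≡⟨ filter-++ (T? ∘ ordered) (map (zero ,_) (map suc (allFin n))) _ ⟩
  filterᵇ ordered (map (zero ,_) (map suc (allFin n))) ++
    filterᵇ ordered (cartesianProduct (map suc (allFin n)) (zero ∷ map suc (allFin n)))
    ≡⟨ cong₂ _++_ (star-edges (allFin n)) (suc-edges (allFin n) (allFin n)) ⟩
  map starEdge (allFin n) ++ map sucEdge (edges n)
    ∎
  where open ≡-Reasoning

-- Vertex 0 is the new vertex: a colours the edges {0, v + 1}, and b the edges {i + 1, j + 1}.
extend : List (Fin n × Fin 3) → List ((Fin n × Fin n) × Fin 3) → List ((Fin (suc n) × Fin (suc n)) × Fin 3)
extend a b = map (map₁ starEdge) a ++ map (map₁ sucEdge) b

isYes-suc≟suc : ∀ (x i : Fin n) → ⌊ suc x ≟ suc i ⌋ ≡ ⌊ x ≟ i ⌋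
isYes-suc≟suc x i with x ≟ i
... | yes _ = refl
... | no _  = refl

lookupColour-sucEdge : ∀ (b : List ((Fin n × Fin n) × Fin 3)) i j →
  lookupColour (map (map₁ sucEdge) b) (suc i) (suc j) ≡ lookupColour b i j
lookupColour-sucEdge []                  i j = refl
lookupColour-sucEdge (((x , y) , c) ∷ b) i j
  rewrite isYes-suc≟suc x i | isYes-suc≟suc y j | lookupColour-sucEdge b i j = refl

lookupColour-extend-suc : ∀ (a : List (Fin n × Fin 3)) b i j → lookupColour (extend a b) (suc i) (suc j) ≡ lookupColour b i j
lookupColour-extend-suc []      b i j = lookupColour-sucEdge b i j
lookupColour-extend-suc (_ ∷ a) b i j = lookupColour-extend-suc a b i j

lookupColour-extend-zero : ∀ (a : List (Fin n × Fin 3)) b {v x} → AllPairs (λ p q → proj₁ p ≢ proj₁ q) a →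
  (v , x) ∈ a → lookupColour (extend a b) zero (suc v) ≡ x
lookupColour-extend-zero ((w , y) ∷ a) b (_ ∷ _) (here refl) with suc w ≟ suc w
... | yes _   = refl
... | no w≢w  = ⊥-elim (w≢w refl)
lookupColour-extend-zero ((w , y) ∷ a) b {v} (w∉a ∷ distinct) (there v∈a) with suc w ≟ suc v
... | yes w≡v = ⊥-elim (All.lookup w∉a v∈a (Finₚ.suc-injective w≡v))
... | no _    = lookupColour-extend-zero a b distinct v∈a

-- b lists each edge {i, j} of K_n once, as (i , j) with i < j.
edgeColour : List ((Fin n × Fin n) × Fin 3) → Fin n → Fin n → Fin 3
edgeColour b i j = if ⌊ i Finₚ.<? j ⌋ then lookupColour b i j else lookupColour b j i

edgeColour-sym : ∀ (b : List ((Fin n × Fin n) × Fin 3)) i j → edgeColour b i j ≡ edgeColour b j i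
edgeColour-sym b i j with i Finₚ.<? j | j Finₚ.<? i
... | yes i<j | yes j<i = ⊥-elim (Finₚ.<-asym i<j j<i)
... | yes _   | no _    = refl
... | no _    | yes _   = refl
... | no i≮j  | no j≮i  with Finₚ.≤-antisym (≮⇒≥ j≮i) (≮⇒≥ i≮j)
...   | refl = refl

edgeColour-< : ∀ (b : List ((Fin n × Fin n) × Fin 3)) {i j} → i Fin.< j → edgeColour b i j ≡ lookupColour b i j
edgeColour-< b {i} {j} i<j with i Finₚ.<? j
... | yes _   = refl
... | no i≮j  = ⊥-elim (i≮j i<j)

nonRainbowTriangle-extend-suc : ∀ (a : List (Fin n × Fin 3)) b i j k →
  nonRainbowTriangle (extend a b) (suc i , suc j , suc k) ≡ nonRainbowTriangle b (i , j , k)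
nonRainbowTriangle-extend-suc a b i j k
  rewrite lookupColour-extend-suc a b i j | lookupColour-extend-suc a b j k | lookupColour-extend-suc a b i k = refl

rainbowFree-extend⇒rainbowFree : ∀ (a : List (Fin n × Fin 3)) b →
  T (rainbowFree (suc n) (extend a b)) → T (rainbowFree n b)
rainbowFree-extend⇒rainbowFree {n} a b rf = all⁻ (nonRainbowTriangle b) (All.tabulate triangle-ok)
  where
  triangle-ok : ∀ {t} → t ∈ triangles n → T (nonRainbowTriangle b t)
  triangle-ok {i , j , k} t∈ with i<j , j<k ← ∈-triangles⁻ t∈ =
    subst T (nonRainbowTriangle-extend-suc a b i j k)
      (All.lookup (all⁺ (nonRainbowTriangle (extend a b)) (triangles (suc n)) rf) (∈-triangles⁺ (s<s i<j) (s<s j<k)))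

module Star {n} (b : List ((Fin n × Fin n) × Fin 3)) = Extensions (edgeColour b) (edgeColour-sym b)

AllPairs-∈ : ∀ {R S : A → A → Set} {xs} → AllPairs R xs →
  (∀ {p q} → p ∈ xs → q ∈ xs → R p q → S p q) → AllPairs S xs
AllPairs-∈ []           R⇒S = []
AllPairs-∈ (row ∷ rows) R⇒S =
  All.tabulate (λ q∈ → R⇒S (here refl) (there q∈) (All.lookup row q∈)) ∷
  AllPairs-∈ rows (λ p∈ q∈ → R⇒S (there p∈) (there q∈))

sorted-by-vertex : ∀ (a : List (Fin n × Fin 3)) → map proj₁ a ≡ allFin n → AllPairs (λ p q → proj₁ p Fin.< proj₁ q) a
sorted-by-vertex a dom = AllPairsₚ.map⁻ (subst (AllPairs Fin._<_) (sym dom) (AllPairsₚ.tabulate⁺-< id))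

lookup-⊤ : ∀ (x : Fin n) → T (lookup ⊤ x)
lookup-⊤ x = subst T (sym (lookup-replicate x true)) _

rainbowFree-extend⇒admissible : ∀ (a : List (Fin n × Fin 3)) b → map proj₁ a ≡ allFin n →
  T (rainbowFree (suc n) (extend a b)) → T (Star.admissible b (λ _ → ⊤) a)
rainbowFree-extend⇒admissible {n} a b dom rf =
  Star.admissible-intro b (λ _ → ⊤) a (All.universal (λ (_ , x) → lookup-⊤ x) a) (AllPairs-∈ sorted compatible)
  where
  sorted : AllPairs (λ p q → proj₁ p Fin.< proj₁ q) a
  sorted = sorted-by-vertex a dom
  compatible : ∀ {(v , x) (w , y) : Fin n × Fin 3} → (v , x) ∈ a → (w , y) ∈ a → v Fin.< w →
               T (lookup (nonRainbow (edgeColour b v w) x) y)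
  compatible {v , x} {w , y} vx∈a wy∈a v<w = subst T star-triangle
    (All.lookup (all⁺ (nonRainbowTriangle (extend a b)) (triangles (suc n)) rf) (∈-triangles⁺ z<s (s<s v<w)))
    where
    distinct = AllPairs.map Finₚ.<⇒≢ sorted
    star-triangle : nonRainbowTriangle (extend a b) (zero , suc v , suc w) ≡ lookup (nonRainbow (edgeColour b v w) x) y
    star-triangle
      rewrite lookupColour-extend-zero a b distinct vx∈a | lookupColour-extend-zero a b distinct wy∈a
            | lookupColour-extend-suc a b v w | edgeColour-< b v<w
            = sym (lookup∘tabulate (λ z → not (allDistinct x (lookupColour b v w) z)) y)

star-extensions≤ : ∀ (b : List ((Fin n × Fin n) × Fin 3)) → Star.extensions b (allFin n) (λ _ → ⊤) ≤ 2 ^ suc n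
star-extensions≤ {n} b = ≤-trans (m≤m+n _ 1) (begin
  Star.extensions b (allFin n) (λ _ → ⊤) + 1            ≤⟨ Star.extensions-bound b (allFin n) (λ _ → ⊤) ⟩
  2 ^ ∑ (allFin n) (λ _ → 1) + 2 ^ ∑ (allFin n) (λ _ → 1)
    ≡⟨ cong (λ m → 2 ^ m + 2 ^ m) (trans (∑-1≡length (allFin n)) (length-tabulate {n = n} id)) ⟩
  2 ^ n + 2 ^ n                                          ≡⟨ cong (2 ^ n +_) (+-identityʳ (2 ^ n)) ⟨
  2 ^ suc n                                              ∎)
  where open ≤-Reasoning

c3RainbowFree-suc : ∀ n → c3RainbowFree (suc n) ≤ 2 ^ suc n * c3RainbowFree n
c3RainbowFree-suc n = begin
  c3RainbowFree (suc n)
    ≡⟨ c3RainbowFree≡∑ (suc n) ⟩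
  ∑ (colourings (edges (suc n))) RF[n+1]
    ≡⟨ cong (λ es → ∑ (colourings es) RF[n+1]) (edges-suc n) ⟩
  ∑ (colourings (map starEdge (allFin n) ++ map sucEdge (edges n))) RF[n+1]
    ≡⟨ ∑-colourings-++ (map starEdge (allFin n)) (map sucEdge (edges n)) RF[n+1] ⟩
  ∑ (colourings (map starEdge (allFin n))) (λ a → ∑ (colourings (map sucEdge (edges n))) (λ b → RF[n+1] (a ++ b)))
    ≡⟨ ∑-colourings-map starEdge (allFin n) _ ⟩
  ∑ (colourings (allFin n)) (λ a → ∑ (colourings (map sucEdge (edges n))) (λ b → RF[n+1] (map (map₁ starEdge) a ++ b)))
    ≡⟨ ∑-cong (colourings (allFin n)) (λ a → ∑-colourings-map sucEdge (edges n) (λ b → RF[n+1] (map (map₁ starEdge) a ++ b))) ⟩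
  ∑ (colourings (allFin n)) (λ a → ∑ (colourings (edges n)) (λ b → RF[n+1] (extend a b)))
    ≤⟨ ∑-colourings-mono (allFin n) (λ a dom → ∑-mono (colourings (edges n)) (λ b → 𝟙-≤-* (λ rf →
         rainbowFree-extend⇒rainbowFree a b rf , rainbowFree-extend⇒admissible a b dom rf))) ⟩
  ∑ (colourings (allFin n)) (λ a → ∑ (colourings (edges n)) (λ b → RF[n] b * 𝟙 (Star.admissible b (λ _ → ⊤) a)))
    ≡⟨ ∑-comm (colourings (allFin n)) (colourings (edges n)) _ ⟩
  ∑ (colourings (edges n)) (λ b → ∑ (colourings (allFin n)) (λ a → RF[n] b * 𝟙 (Star.admissible b (λ _ → ⊤) a)))
    ≡⟨ ∑-cong (colourings (edges n)) (λ b → trans (∑-*ˡ (RF[n] b) (colourings (allFin n)) _)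
         (cong (RF[n] b *_) (Star.∑-admissible b (allFin n) (λ _ → ⊤)))) ⟩
  ∑ (colourings (edges n)) (λ b → RF[n] b * Star.extensions b (allFin n) (λ _ → ⊤))
    ≤⟨ ∑-mono (colourings (edges n)) (λ b → ≤-trans (*-monoʳ-≤ (RF[n] b) (star-extensions≤ b)) (≤-reflexive (*-comm (RF[n] b) (2 ^ suc n)))) ⟩
  ∑ (colourings (edges n)) (λ b → 2 ^ suc n * RF[n] b)
    ≡⟨ ∑-*ˡ (2 ^ suc n) (colourings (edges n)) RF[n] ⟩
  2 ^ suc n * ∑ (colourings (edges n)) RF[n]
    ≡⟨ cong (2 ^ suc n *_) (c3RainbowFree≡∑ n) ⟨
  2 ^ suc n * c3RainbowFree n
    ∎
  where
  open ≤-Reasoning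
  RF[n+1] : List ((Fin (suc n) × Fin (suc n)) × Fin 3) → ℕ
  RF[n+1] l = 𝟙 (rainbowFree (suc n) l)
  RF[n] : List ((Fin n × Fin n) × Fin 3) → ℕ
  RF[n] l = 𝟙 (rainbowFree n l)

factorial-bound-step : ∀ j c c′ → 1 ≤ j → c′ ≤ 2 ^ suc (suc j) * c →
  2 * c ≤ 3 * (j !) * 2 ^ (suc j C 2) → 2 * c′ ≤ 3 * (suc j !) * 2 ^ (suc (suc j) C 2)
factorial-bound-step j c c′ 1≤j c′≤ 2c≤ = begin
  2 * c′                                          ≤⟨ *-monoʳ-≤ 2 c′≤ ⟩
  2 * (2 ^ suc k * c)                             ≡⟨ solve 2 (λ p q → con 2 :* (p :* q) := p :* (con 2 :* q)) refl (2 ^ suc k) c ⟩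
  2 ^ suc k * (2 * c)                             ≤⟨ *-monoʳ-≤ (2 ^ suc k) 2c≤ ⟩
  2 * 2 ^ k * (3 * (j !) * 2 ^ (k C 2))           ≤⟨ *-monoˡ-≤ (3 * (j !) * 2 ^ (k C 2)) (*-monoˡ-≤ (2 ^ k) (s≤s 1≤j)) ⟩
  k * 2 ^ k * (3 * (j !) * 2 ^ (k C 2))           ≡⟨ solve 4 (λ k f p q → k :* p :* (con 3 :* f :* q) := con 3 :* (k :* f) :* (p :* q)) refl k (j !) (2 ^ k) (2 ^ (k C 2)) ⟩
  3 * (k !) * (2 ^ k * 2 ^ (k C 2))               ≡⟨ cong (3 * (k !) *_) (^-distribˡ-+-* 2 k (k C 2)) ⟨
  3 * (k !) * 2 ^ (k + k C 2)                     ≡⟨ cong (λ m → 3 * (k !) * 2 ^ (m + k C 2)) (nC1≡n k) ⟨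
  3 * (k !) * 2 ^ (k C 1 + k C 2)                 ≡⟨ cong (λ m → 3 * (k !) * 2 ^ m) (nCk+nC[k+1]≡[n+1]C[k+1] k 1) ⟩
  3 * (k !) * 2 ^ (suc k C 2)                     ∎
  where
  open ≤-Reasoning
  k : ℕ
  k = suc j

c3RainbowFree-2 : c3RainbowFree 2 ≡ 3
c3RainbowFree-2 = refl

theorem4p6 : (n : ℕ) → 2 ≤ n →
    2 * c3RainbowFree n ≤ 3 * ((n ∸ 1) !) * 2 ^ (n C 2)
theorem4p6 (suc zero)          (s≤s ())
theorem4p6 (suc (suc zero))    _ rewrite c3RainbowFree-2 = ≤-refl
theorem4p6 (suc (suc (suc j))) _ =
  factorial-bound-step (suc j) (c3RainbowFree (2 + j)) (c3RainbowFree (3 + j)) (s≤s z≤n)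
    (c3RainbowFree-suc (2 + j)) (theorem4p6 (suc (suc j)) (s≤s (s≤s z≤n)))
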